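{- For every positive integer $k$ there exists a quasi-perfect $1$-error-correcting code in the Cartesian product $C_3 \square C_6 \square C_{4k}$, and for all positive integers $p,q,k$ there exists a quasi-perfect $1$-error-correcting code in $C_{3p} \square C_{6q} \square C_{4k}$.
   Context: All graphs are simple and connected; $d(x,y)$ is the shortest-path distance. For $n\ge 3$, $C_n$ is the cycle on $n$ vertices. The Cartesian product $G\square H$ has vertex set $V(G)\times V(H)$, with $(g_1,h_1)$ adjacent to $(g_2,h_2)$ iff either $h_1=h_2$ and $g_1g_2\in E(G)$, or $g_1=g_2$ and $h_1h_2\in E(H)$. A code is a subset $D$ of the vertex set. $D$ is $t$-error-correcting if any two distinct codewords are at distance at least $2t+1$. The covering radius of $D$ is the smallest $r$ such that every vertex is at distance at most $r$ from some codeword. A quasi-perfect $t$-error-correcting code is a $t$-error-correcting code with covering radius $t+1$. -}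

module Defs where

open import Level using (0ℓ)
open import Data.Nat using (ℕ; zero; suc; _+_; _*_; _≤_)
open import Data.Fin using (Fin; toℕ)
open import Data.Product using (Σ; _×_; _,_)
open import Data.Sum using (_⊎_)
open import Relation.Binary.PropositionalEquality using (_≡_; _≢_)
open import Relation.Nullary using (¬_)

record Graph : Set₁ where
  field
    V   : Set
    Adj : V → V → Set
open Graph public

-- The cycle C_n on vertices 0,…,n-1: i ~ j iff j = i+1 or i = j+1 (mod n),
-- i.e. they differ by one, or one is 0 and the other is n-1.
CycleAdj : (n : ℕ) → Fin n → Fin n → Set
CycleAdj n i j =
  (suc (toℕ i) ≡ toℕ j) ⊎ (suc (toℕ j) ≡ toℕ i)
  ⊎ ((toℕ i ≡ 0) × (suc (toℕ j) ≡ n))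
  ⊎ ((toℕ j ≡ 0) × (suc (toℕ i) ≡ n))

Cycle : ℕ → Graph
Cycle n = record { V = Fin n ; Adj = CycleAdj n }

_□_ : Graph → Graph → Graph
G □ H = record
  { V   = V G × V H
  ; Adj = λ { (g₁ , h₁) (g₂ , h₂) →
              ((h₁ ≡ h₂) × Adj G g₁ g₂) ⊎ ((g₁ ≡ g₂) × Adj H h₁ h₂) } }
infixl 6 _□_

-- Within r G x y : there is a walk of length at most r from x to y,
-- i.e. the shortest-path distance satisfies d(x,y) ≤ r.
data Within (G : Graph) : ℕ → V G → V G → Set where
  here : ∀ {r x} → Within G r x x
  step : ∀ {r x y z} → Adj G x y → Within G r y z → Within G (suc r) x z

Code : Graph → Set₁
Code G = V G → Set

-- t-error-correcting: distinct codewords are at distance ≥ 2t+1,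
-- i.e. not at distance ≤ 2t.
ErrorCorrecting : (G : Graph) → ℕ → Code G → Set
ErrorCorrecting G t D =
  ∀ x y → D x → D y → x ≢ y → ¬ Within G (2 * t) x y

Covers : (G : Graph) → ℕ → Code G → Set
Covers G r D = ∀ v → Σ (V G) λ c → D c × Within G r v c

CoveringRadius : (G : Graph) → Code G → ℕ → Set
CoveringRadius G D r = Covers G r D × (∀ s → suc s ≤ r → ¬ Covers G s D)

QuasiPerfect : (G : Graph) → ℕ → Code G → Set
QuasiPerfect G t D = ErrorCorrecting G t D × CoveringRadius G D (suc t)

-- Reduction of coordinates modulo 3, 6 and 4 is a covering map from
-- C_{3p} □ C_{6q} □ C_{4k} onto C₃ □ C₆ □ C₄: it maps edges to edges, lifts
-- edges, and, all cycles having length at least 3, never identifies the two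
-- ends of a walk of length 2.  Hence preimages of codewords stay at distance
-- at least 3, and walks witnessing the covering radius can be pushed down
-- and lifted.  This reduces the theorem to the code 4a + 2b + 3c ≡ 0 (mod 12)
-- in C₃ □ C₆ □ C₄, which is checked by exhaustively computing balls of radius 2.
module Submission where

open import Defs
open import Data.Nat using (ℕ; suc; _*_)
open import Data.Product using (Σ; _×_)

open import Function using (_∘_)
open import Data.Nat using (zero; _+_; _%_; _≤_; s≤s; z≤n; NonZero; >-nonZero)
open import Data.Nat.Properties using (_≟_; suc-injective; ≤∧≢⇒<; <-asym; <⇒≢; ≤-reflexive; ≤-trans; <-≤-trans)
open import Data.Nat.DivMod using (_mod_; n%n≡0; m<n⇒m%n≡m; m%n%n≡m%n; %-distribˡ-+; m∣n⇒o%n%m≡o%m)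
open import Data.Nat.Divisibility using (_∣_; ∣⇒≤; m∣m*n)
open import Data.Fin using (Fin; toℕ; fromℕ; fromℕ<; inject₁) renaming (zero to fzero; suc to fsuc)
open import Data.Fin.Properties using (toℕ-injective; toℕ<n; toℕ-fromℕ<; toℕ-fromℕ; toℕ-inject₁) renaming (all? to Fin-all?)
import Data.Fin.Properties as Fin
open import Data.Product using (_,_; proj₁; proj₂)
open import Data.Product.Properties using (≡-dec)
open import Data.Sum using (_⊎_; inj₁; inj₂) renaming (map to ⊎-map)
open import Data.Empty using (⊥-elim)
open import Data.List using (List; []; _∷_; _++_; map)
open import Data.List.Relation.Unary.Any using (Any; here; there; any?)
open import Data.List.Membership.Propositional using (_∈_; find; lose)
open import Data.List.Membership.Propositional.Properties using (∈-map⁺; ∈-map⁻; ∈-++⁺ˡ; ∈-++⁺ʳ; ∈-++⁻)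
open import Relation.Nullary using (¬_; Dec; yes; no; ¬?)
open import Relation.Nullary.Decidable using (from-yes; from-no; map′; _×-dec_; _⊎-dec_; _→-dec_)
open import Relation.Unary using (Decidable)
open import Relation.Binary.Definitions using (DecidableEquality)
open import Relation.Binary.PropositionalEquality using (_≡_; _≢_; refl; sym; trans; cong; subst; module ≡-Reasoning)

Loopless : Graph → Set
Loopless G = ∀ {x} → ¬ Adj G x x

□-loopless : ∀ {G H} → Loopless G → Loopless H → Loopless (G □ H)
□-loopless loopG loopH (inj₁ (_ , a)) = loopG a
□-loopless loopG loopH (inj₂ (_ , a)) = loopH a

Next : (n : ℕ) → Fin n → Fin n → Set
Next n i j = (suc (toℕ i) ≡ toℕ j) ⊎ (toℕ j ≡ 0 × suc (toℕ i) ≡ n)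

CycleAdj⇒Next : ∀ {n} {i j : Fin n} → CycleAdj n i j → Next n i j ⊎ Next n j i
CycleAdj⇒Next (inj₁ e)                  = inj₁ (inj₁ e)
CycleAdj⇒Next (inj₂ (inj₁ e))           = inj₂ (inj₁ e)
CycleAdj⇒Next (inj₂ (inj₂ (inj₁ wrap))) = inj₂ (inj₂ wrap)
CycleAdj⇒Next (inj₂ (inj₂ (inj₂ wrap))) = inj₁ (inj₂ wrap)

Next⇒CycleAdj : ∀ {n} {i j : Fin n} → Next n i j ⊎ Next n j i → CycleAdj n i j
Next⇒CycleAdj (inj₁ (inj₁ e))    = inj₁ e
Next⇒CycleAdj (inj₁ (inj₂ wrap)) = inj₂ (inj₂ (inj₂ wrap))
Next⇒CycleAdj (inj₂ (inj₁ e))    = inj₂ (inj₁ e)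
Next⇒CycleAdj (inj₂ (inj₂ wrap)) = inj₂ (inj₂ (inj₁ wrap))

module _ {n : ℕ} .{{_ : NonZero n}} {i j : Fin n} where

  Next⇒toℕ≡ : Next n i j → toℕ j ≡ suc (toℕ i) % n
  Next⇒toℕ≡ (inj₁ e)          = sym (trans (cong (_% n) e) (m<n⇒m%n≡m (toℕ<n j)))
  Next⇒toℕ≡ (inj₂ (j≡0 , e)) = trans j≡0 (sym (trans (cong (_% n) e) (n%n≡0 n)))

  toℕ≡⇒Next : toℕ j ≡ suc (toℕ i) % n → Next n i j
  toℕ≡⇒Next e with suc (toℕ i) ≟ n
  ... | yes wraps = inj₂ (trans e (trans (cong (_% n) wraps) (n%n≡0 n)) , wraps)
  ... | no ¬wraps = inj₁ (sym (trans e (m<n⇒m%n≡m (≤∧≢⇒< (toℕ<n i) ¬wraps))))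

Next-functional : ∀ {n} .{{_ : NonZero n}} {i j k : Fin n} → Next n i j → Next n i k → j ≡ k
Next-functional f g = toℕ-injective (trans (Next⇒toℕ≡ f) (sym (Next⇒toℕ≡ g)))

Next-injective : ∀ {n} {i j k : Fin n} → Next n i k → Next n j k → i ≡ j
Next-injective (inj₁ e) (inj₁ e′) = toℕ-injective (suc-injective (trans e (sym e′)))
Next-injective (inj₁ e) (inj₂ (k≡0 , _)) with trans e k≡0
... | ()
Next-injective (inj₂ (k≡0 , _)) (inj₁ e′) with trans e′ k≡0
... | ()
Next-injective (inj₂ (_ , e)) (inj₂ (_ , e′)) = toℕ-injective (suc-injective (trans e (sym e′)))

Next-asym : ∀ {n} {i j : Fin n} → 3 ≤ n → Next n i j → ¬ Next n j i
Next-asym _   (inj₁ e)          (inj₁ e′)          = <-asym (≤-reflexive e) (≤-reflexive e′)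
Next-asym 3≤n (inj₁ e)          (inj₂ (i≡0 , e′)) = <⇒≢ 3≤n (trans (cong suc (trans (cong suc (sym i≡0)) e)) e′)
Next-asym 3≤n (inj₂ (j≡0 , e)) (inj₁ e′)          = <⇒≢ 3≤n (trans (cong suc (trans (cong suc (sym j≡0)) e′)) e)
Next-asym 3≤n (inj₂ (_ , e))    (inj₂ (i≡0 , _))   = <⇒≢ (≤-trans (s≤s (s≤s z≤n)) 3≤n) (trans (cong suc (sym i≡0)) e)

[1+m%n]%n≡[1+m]%n : ∀ m n .{{_ : NonZero n}} → suc (m % n) % n ≡ suc m % n
[1+m%n]%n≡[1+m]%n m n = begin
  (1 + m % n) % n          ≡⟨ %-distribˡ-+ 1 (m % n) n ⟩
  (1 % n + m % n % n) % n  ≡⟨ cong (λ r → (1 % n + r) % n) (m%n%n≡m%n m n) ⟩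
  (1 % n + m % n) % n      ≡⟨ %-distribˡ-+ 1 m n ⟨
  (1 + m) % n              ∎
  where open ≡-Reasoning

next : ∀ {n} .{{_ : NonZero n}} → Fin n → Fin n
next {n} i = suc (toℕ i) mod n

prev : ∀ {n} → Fin n → Fin n
prev {suc n} fzero = fromℕ n
prev (fsuc i)      = inject₁ i

Next-next : ∀ {n} .{{_ : NonZero n}} (i : Fin n) → Next n i (next i)
Next-next i = toℕ≡⇒Next (toℕ-fromℕ< _)

Next-prev : ∀ {n} (i : Fin n) → Next n (prev i) i
Next-prev {suc n} fzero = inj₂ (refl , cong suc (toℕ-fromℕ n))
Next-prev (fsuc i)      = inj₁ (cong suc (toℕ-inject₁ i))

Cycle-loopless : ∀ {n} → 3 ≤ n → Loopless (Cycle n)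
Cycle-loopless 3≤n adj with CycleAdj⇒Next adj
... | inj₁ f = Next-asym 3≤n f f
... | inj₂ f = Next-asym 3≤n f f

Within-mono : ∀ {G r s x y} → r ≤ s → Within G r x y → Within G s x y
Within-mono _         here       = here
Within-mono (s≤s r≤s) (step a w) = step a (Within-mono r≤s w)

Covers-mono : ∀ {G r s D} → r ≤ s → Covers G r D → Covers G s D
Covers-mono r≤s cover v = let (c , c∈D , w) = cover v in c , c∈D , Within-mono r≤s w

coveringRadius : ∀ {G r D} → Covers G (suc r) D → ¬ Covers G r D → CoveringRadius G D (suc r)
coveringRadius cover ¬cover = cover , λ { s (s≤s s≤r) → ¬cover ∘ Covers-mono s≤r }

-- Deciding distances in finite graphs

record LocallyFinite (G : Graph) : Set where
  field
    neighbours : V G → List (V G)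
    adj⇒∈      : ∀ {x y} → Adj G x y → y ∈ neighbours x
    ∈⇒adj      : ∀ {x y} → y ∈ neighbours x → Adj G x y

Cycle-locallyFinite : ∀ {n} .{{_ : NonZero n}} → LocallyFinite (Cycle n)
Cycle-locallyFinite = record
  { neighbours = λ i → next i ∷ prev i ∷ []
  ; adj⇒∈      = adj⇒∈
  ; ∈⇒adj      = ∈⇒adj
  }
  where
  adj⇒∈ : ∀ {i j} → CycleAdj _ i j → j ∈ next i ∷ prev i ∷ []
  adj⇒∈ {i} adj with CycleAdj⇒Next adj
  ... | inj₁ f = here (Next-functional f (Next-next i))
  ... | inj₂ f = there (here (Next-injective f (Next-prev i)))

  ∈⇒adj : ∀ {i j} → j ∈ next i ∷ prev i ∷ [] → CycleAdj _ i j
  ∈⇒adj {i} (here refl)         = Next⇒CycleAdj (inj₁ (Next-next i))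
  ∈⇒adj {i} (there (here refl)) = Next⇒CycleAdj (inj₂ (Next-prev i))

□-locallyFinite : ∀ {G H} → LocallyFinite G → LocallyFinite H → LocallyFinite (G □ H)
□-locallyFinite {G} {H} finG finH = record
  { neighbours = neighbours
  ; adj⇒∈      = adj⇒∈
  ; ∈⇒adj      = ∈⇒adj
  }
  where
  module FG = LocallyFinite finG
  module FH = LocallyFinite finH

  neighbours : V (G □ H) → List (V (G □ H))
  neighbours (g , h) = map (_, h) (FG.neighbours g) ++ map (g ,_) (FH.neighbours h)

  adj⇒∈ : ∀ {x y} → Adj (G □ H) x y → y ∈ neighbours x
  adj⇒∈ (inj₁ (refl , a)) = ∈-++⁺ˡ (∈-map⁺ _ (FG.adj⇒∈ a))
  adj⇒∈ (inj₂ (refl , a)) = ∈-++⁺ʳ _ (∈-map⁺ _ (FH.adj⇒∈ a))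

  ∈⇒adj : ∀ {x y} → y ∈ neighbours x → Adj (G □ H) x y
  ∈⇒adj {g , h} y∈ with ∈-++⁻ (map (_, h) (FG.neighbours g)) y∈
  ... | inj₁ y∈G with ∈-map⁻ (_, h) y∈G
  ...   | _ , g′∈ , refl = inj₁ (refl , FG.∈⇒adj g′∈)
  ∈⇒adj {g , h} y∈ | inj₂ y∈H with ∈-map⁻ (g ,_) y∈H
  ...   | _ , h′∈ , refl = inj₂ (refl , FH.∈⇒adj h′∈)

Exhaustible : Set → Set₁
Exhaustible A = ∀ {P : A → Set} → Decidable P → Dec (∀ x → P x)

×-exhaustible : ∀ {A B} → Exhaustible A → Exhaustible B → Exhaustible (A × B)
×-exhaustible allA allB P? =
  map′ (λ h (a , b) → h a b) (λ h a b → h (a , b)) (allA λ a → allB λ b → P? (a , b))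

module Distances {G : Graph} (finite : LocallyFinite G) where
  open LocallyFinite finite

  Reach : (V G → Set) → ℕ → V G → Set
  Reach P zero    x = P x
  Reach P (suc r) x = P x ⊎ Any (Reach P r) (neighbours x)

  reach? : ∀ {P} → Decidable P → ∀ r → Decidable (Reach P r)
  reach? P? zero    x = P? x
  reach? P? (suc r) x = P? x ⊎-dec any? (reach? P? r) (neighbours x)

  Reach⇒Within : ∀ {P} r {x} → Reach P r x → Σ (V G) λ y → P y × Within G r x y
  Reach⇒Within zero    {x} px        = x , px , here
  Reach⇒Within (suc r) {x} (inj₁ px) = x , px , here
  Reach⇒Within (suc r) (inj₂ reach) with find reach
  ... | z , z∈ , reachᶻ with Reach⇒Within r reachᶻ
  ...   | y , py , w = y , py , step (∈⇒adj z∈) w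

  Within⇒Reach : ∀ {P} r {x y} → P y → Within G r x y → Reach P r x
  Within⇒Reach zero    py here       = py
  Within⇒Reach (suc r) py here       = inj₁ py
  Within⇒Reach (suc r) py (step a w) = inj₂ (lose (adj⇒∈ a) (Within⇒Reach r py w))

  module _ (D : Code G) where

    Isolated : ℕ → V G → Set
    Isolated t x = ¬ Reach (λ y → D y × y ≢ x) (2 * t) x

    isolated⇒errorCorrecting : ∀ {t} → (∀ x → D x → Isolated t x) → ErrorCorrecting G t D
    isolated⇒errorCorrecting {t} isolated x y x∈D y∈D x≢y w =
      isolated x x∈D (Within⇒Reach (2 * t) (y∈D , x≢y ∘ sym) w)

    errorCorrecting⇒isolated : ∀ {t} → ErrorCorrecting G t D → ∀ x → D x → Isolated t x
    errorCorrecting⇒isolated {t} ec x x∈D reach with Reach⇒Within (2 * t) reach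
    ... | y , (y∈D , y≢x) , w = ec x y x∈D y∈D (y≢x ∘ sym) w

    module Decision (all? : Exhaustible (V G)) (D? : Decidable D) where

      covers? : ∀ r → Dec (Covers G r D)
      covers? r = map′ (λ reach v → Reach⇒Within r (reach v))
                       (λ cover v → let (_ , c∈D , w) = cover v in Within⇒Reach r c∈D w)
                       (all? (reach? D? r))

      errorCorrecting? : DecidableEquality (V G) → ∀ t → Dec (ErrorCorrecting G t D)
      errorCorrecting? _≟ᵥ_ t =
        map′ (isolated⇒errorCorrecting {t}) (errorCorrecting⇒isolated {t})
             (all? λ x → D? x →-dec ¬? (reach? (λ y → D? y ×-dec ¬? (y ≟ᵥ x)) (2 * t) x))

-- Coverings

record Covering (G H : Graph) : Set where
  field
    π                  : V G → V H
    π-surjective       : ∀ u → Σ (V G) λ x → π x ≡ u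
    π-adj              : ∀ {x y} → Adj G x y → Adj H (π x) (π y)
    lift-adj           : ∀ {x u} → Adj H (π x) u → Σ (V G) λ y → Adj G x y × π y ≡ u
    two-step-injective : ∀ {x y z} → Adj G x z → Adj G z y → π x ≡ π y → x ≡ y

module _ {G H : Graph} (cov : Covering G H) where
  open Covering cov

  π-within : ∀ {r x y} → Within G r x y → Within H r (π x) (π y)
  π-within here       = here
  π-within (step a w) = step (π-adj a) (π-within w)

  lift-within : ∀ {r x u} → Within H r (π x) u → Σ (V G) λ y → Within G r x y × π y ≡ u
  lift-within {x = x} here = x , here , refl
  lift-within (step a w) with lift-adj a
  ... | z , a′ , refl with lift-within w
  ...   | y , w′ , πy≡u = y , step a′ w′ , πy≡u

  errorCorrecting₁-pullback : ∀ {D} → Loopless H → ErrorCorrecting H 1 D → ErrorCorrecting G 1 (D ∘ π)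
  errorCorrecting₁-pullback loopless ec x y x∈D y∈D x≢y w =
    ec (π x) (π y) x∈D y∈D (separated w) (π-within w)
    where
    separated : Within G 2 x y → π x ≢ π y
    separated here                   = λ _ → x≢y refl
    separated (step a here)          = λ πx≡πy → loopless (subst (Adj H (π x)) (sym πx≡πy) (π-adj a))
    separated (step a (step b here)) = x≢y ∘ two-step-injective a b

  covers-pullback : ∀ {r D} → Covers H r D → Covers G r (D ∘ π)
  covers-pullback cover x with cover (π x)
  ... | c , c∈D , w with lift-within w
  ...   | y , w′ , refl = y , c∈D , w′

  covers-pushforward : ∀ {r D} → Covers G r (D ∘ π) → Covers H r D
  covers-pushforward cover u with π-surjective u
  ... | x , refl with cover x
  ...   | c , c∈D , w = π c , c∈D , π-within w

  coveringRadius-pullback : ∀ {r D} → CoveringRadius H D r → CoveringRadius G (D ∘ π) r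
  coveringRadius-pullback (cover , ¬cover) =
    covers-pullback cover , λ s s<r → ¬cover s s<r ∘ covers-pushforward

  quasiPerfect₁-pullback : ∀ {D} → Loopless H → QuasiPerfect H 1 D → QuasiPerfect G 1 (D ∘ π)
  quasiPerfect₁-pullback loopless (ec , radius) =
    errorCorrecting₁-pullback loopless ec , coveringRadius-pullback radius

module _ {m n : ℕ} .{{_ : NonZero n}} (3≤m : 3 ≤ m) (m∣n : m ∣ n) where

  private instance
    m-nonZero : NonZero m
    m-nonZero = >-nonZero (≤-trans (s≤s z≤n) 3≤m)

  reduce : Fin n → Fin m
  reduce i = toℕ i mod m

  toℕ-reduce : ∀ i → toℕ (reduce i) ≡ toℕ i % m
  toℕ-reduce i = toℕ-fromℕ< _

  reduce-Next : ∀ {i j} → Next n i j → Next m (reduce i) (reduce j)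
  reduce-Next {i} {j} f = toℕ≡⇒Next (begin
    toℕ (reduce j)            ≡⟨ toℕ-reduce j ⟩
    toℕ j % m                 ≡⟨ cong (_% m) (Next⇒toℕ≡ f) ⟩
    suc (toℕ i) % n % m       ≡⟨ m∣n⇒o%n%m≡o%m m n (suc (toℕ i)) m∣n ⟩
    suc (toℕ i) % m           ≡⟨ [1+m%n]%n≡[1+m]%n (toℕ i) m ⟨
    suc (toℕ i % m) % m       ≡⟨ cong (λ r → suc r % m) (toℕ-reduce i) ⟨
    suc (toℕ (reduce i)) % m  ∎)
    where open ≡-Reasoning

  Cycle-covering : Covering (Cycle n) (Cycle m)
  Cycle-covering = record
    { π                  = reduce
    ; π-surjective       = π-surjective
    ; π-adj              = λ adj → Next⇒CycleAdj (⊎-map reduce-Next reduce-Next (CycleAdj⇒Next adj))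
    ; lift-adj           = lift-adj
    ; two-step-injective = two-step-injective
    }
    where
    π-surjective : ∀ u → Σ (Fin n) λ i → reduce i ≡ u
    π-surjective u = i , toℕ-injective (begin
      toℕ (reduce i)  ≡⟨ toℕ-reduce i ⟩
      toℕ i % m       ≡⟨ cong (_% m) (toℕ-fromℕ< u<n) ⟩
      toℕ u % m       ≡⟨ m<n⇒m%n≡m (toℕ<n u) ⟩
      toℕ u           ∎)
      where
      open ≡-Reasoning
      u<n = <-≤-trans (toℕ<n u) (∣⇒≤ m∣n)
      i = fromℕ< u<n

    lift-adj : ∀ {i u} → CycleAdj m (reduce i) u → Σ (Fin n) λ j → CycleAdj n i j × reduce j ≡ u
    lift-adj {i} adj with CycleAdj⇒Next adj
    ... | inj₁ f = next i , Next⇒CycleAdj (inj₁ (Next-next i)) , Next-functional (reduce-Next (Next-next i)) f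
    ... | inj₂ f = prev i , Next⇒CycleAdj (inj₂ (Next-prev i)) , Next-injective (reduce-Next (Next-prev i)) f

    two-step-injective : ∀ {i j k} → CycleAdj n i k → CycleAdj n k j → reduce i ≡ reduce j → i ≡ j
    two-step-injective a b ri≡rj with CycleAdj⇒Next a | CycleAdj⇒Next b
    ... | inj₁ f | inj₁ g = ⊥-elim (Next-asym 3≤m (reduce-Next f) (subst (Next m _) (sym ri≡rj) (reduce-Next g)))
    ... | inj₁ f | inj₂ g = Next-injective f g
    ... | inj₂ f | inj₁ g = Next-functional f g
    ... | inj₂ f | inj₂ g = ⊥-elim (Next-asym 3≤m (reduce-Next f) (subst (λ r → Next m r _) (sym ri≡rj) (reduce-Next g)))

□-covering : ∀ {G G′ H H′} → Loopless G′ → Loopless H′ →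
             Covering G G′ → Covering H H′ → Covering (G □ H) (G′ □ H′)
□-covering {G} {G′} {H} {H′} loopG′ loopH′ covG covH = record
  { π                  = π
  ; π-surjective       = π-surjective
  ; π-adj              = π-adj
  ; lift-adj           = lift-adj
  ; two-step-injective = two-step-injective
  }
  where
  module CG = Covering covG
  module CH = Covering covH

  π : V (G □ H) → V (G′ □ H′)
  π (g , h) = CG.π g , CH.π h

  π-surjective : ∀ u → Σ (V (G □ H)) λ x → π x ≡ u
  π-surjective (g′ , h′) with CG.π-surjective g′ | CH.π-surjective h′
  ... | g , refl | h , refl = (g , h) , refl

  π-adj : ∀ {x y} → Adj (G □ H) x y → Adj (G′ □ H′) (π x) (π y)
  π-adj (inj₁ (refl , a)) = inj₁ (refl , CG.π-adj a)
  π-adj (inj₂ (refl , a)) = inj₂ (refl , CH.π-adj a)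

  lift-adj : ∀ {x u} → Adj (G′ □ H′) (π x) u → Σ (V (G □ H)) λ y → Adj (G □ H) x y × π y ≡ u
  lift-adj {g , h} (inj₁ (refl , a)) with CG.lift-adj a
  ... | g′ , a′ , refl = (g′ , h) , inj₁ (refl , a′) , refl
  lift-adj {g , h} (inj₂ (refl , a)) with CH.lift-adj a
  ... | h′ , a′ , refl = (g , h′) , inj₂ (refl , a′) , refl

  two-step-injective : ∀ {x y z} → Adj (G □ H) x z → Adj (G □ H) z y → π x ≡ π y → x ≡ y
  two-step-injective {_ , h} (inj₁ (refl , a)) (inj₁ (refl , b)) πx≡πy =
    cong (_, h) (CG.two-step-injective a b (cong proj₁ πx≡πy))
  two-step-injective (inj₁ (refl , a)) (inj₂ (refl , _)) πx≡πy =
    ⊥-elim (loopG′ (subst (Adj G′ _) (sym (cong proj₁ πx≡πy)) (CG.π-adj a)))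
  two-step-injective (inj₂ (refl , a)) (inj₁ (refl , _)) πx≡πy =
    ⊥-elim (loopH′ (subst (Adj H′ _) (sym (cong proj₂ πx≡πy)) (CH.π-adj a)))
  two-step-injective {g , _} (inj₂ (refl , a)) (inj₂ (refl , b)) πx≡πy =
    cong (g ,_) (CH.two-step-injective a b (cong proj₂ πx≡πy))

Torus : Graph
Torus = Cycle 3 □ Cycle 6 □ Cycle 4

torusCode : Code Torus
torusCode ((a , b) , c) = (4 * toℕ a + 2 * toℕ b + 3 * toℕ c) % 12 ≡ 0

torusCode-quasiPerfect : QuasiPerfect Torus 1 torusCode
torusCode-quasiPerfect =
  from-yes (errorCorrecting? _≟ᵥ_ 1) ,
  coveringRadius (from-yes (covers? 2)) (from-no (covers? 1))
  where
  all? : Exhaustible (V Torus)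
  all? = ×-exhaustible (×-exhaustible Fin-all? Fin-all?) Fin-all?

  _≟ᵥ_ : DecidableEquality (V Torus)
  _≟ᵥ_ = ≡-dec (≡-dec Fin._≟_ Fin._≟_) Fin._≟_

  torusCode? : Decidable torusCode
  torusCode? ((a , b) , c) = (4 * toℕ a + 2 * toℕ b + 3 * toℕ c) % 12 ≟ 0

  open Distances (□-locallyFinite (□-locallyFinite Cycle-locallyFinite Cycle-locallyFinite) Cycle-locallyFinite)
  open Decision torusCode all? torusCode?

3≤3+ : ∀ n → 3 ≤ 3 + n
3≤3+ n = s≤s (s≤s (s≤s z≤n))

C₃□C₆-loopless : Loopless (Cycle 3 □ Cycle 6)
C₃□C₆-loopless = □-loopless {Cycle 3} {Cycle 6} (Cycle-loopless (3≤3+ 0)) (Cycle-loopless (3≤3+ 3))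

Torus-loopless : Loopless Torus
Torus-loopless = □-loopless {Cycle 3 □ Cycle 6} {Cycle 4} C₃□C₆-loopless (Cycle-loopless (3≤3+ 1))

Torus-covering : ∀ p q k → Covering (Cycle (3 * suc p) □ Cycle (6 * suc q) □ Cycle (4 * suc k)) Torus
Torus-covering p q k =
  □-covering C₃□C₆-loopless (Cycle-loopless (3≤3+ 1))
    (□-covering (Cycle-loopless (3≤3+ 0)) (Cycle-loopless (3≤3+ 3))
       (Cycle-covering (3≤3+ 0) (m∣m*n (suc p)))
       (Cycle-covering (3≤3+ 3) (m∣m*n (suc q))))
    (Cycle-covering (3≤3+ 1) (m∣m*n (suc k)))

theorem5 : ((k : ℕ) → Σ (Code (Cycle 3 □ Cycle 6 □ Cycle (4 * suc k))) λ D →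
              QuasiPerfect (Cycle 3 □ Cycle 6 □ Cycle (4 * suc k)) 1 D)
           × ((p q k : ℕ) → Σ (Code (Cycle (3 * suc p) □ Cycle (6 * suc q) □ Cycle (4 * suc k))) λ D →
              QuasiPerfect (Cycle (3 * suc p) □ Cycle (6 * suc q) □ Cycle (4 * suc k)) 1 D)
theorem5 = lift 0 0 , lift
  where
  lift : (p q k : ℕ) → Σ (Code (Cycle (3 * suc p) □ Cycle (6 * suc q) □ Cycle (4 * suc k))) λ D →
           QuasiPerfect (Cycle (3 * suc p) □ Cycle (6 * suc q) □ Cycle (4 * suc k)) 1 D
  lift p q k = torusCode ∘ π , quasiPerfect₁-pullback cov Torus-loopless torusCode-quasiPerfect
    where
    cov = Torus-covering p q k
    open Covering cov using (π)
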